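{- Let $P$ and $Q$ be Interface Automata with common input alphabet $I$, common output alphabet $O$ and disjoint state sets, and let $p\in P$, $q\in Q$. Then $[\![p]\!]\vee[\![q]\!]\sqsubseteq_{\mathrm{MIA}}[\![p\vee q]\!]$, where $p\vee q$ is the state of the IA-disjunction $P\vee Q$ and $[\![p]\!]\vee[\![q]\!]$ is the state of the MIA-disjunction $[\![P]\!]\vee[\![Q]\!]$.
   Context: IA: $P=(P,I,O,\rightarrow_P)$, states $P$, disjoint action sets $I,O$ not containing $\tau$, $\rightarrow_P\subseteq P\times(I\cup O\cup\{\tau\})\times P$ input-deterministic (for $a\in I$, $p\xrightarrow{a}p'$ and $p\xrightarrow{a}p''$ imply $p'=p''$). IA-disjunction $P\vee Q$ (common alphabets, disjoint state sets): states $\{p\vee q: p\in P,q\in Q\}\cup P\cup Q$, least transition relation containing $\rightarrow_P,\rightarrow_Q$ and satisfying (I) $p\vee q\xrightarrow{a}p'\vee q'$ if $p\xrightarrow{a}_Pp'$, $q\xrightarrow{a}_Qq'$, $a\in I$; (OT1) $p\vee q\xrightarrow{\alpha}p'$ if $p\xrightarrow{\alpha}_Pp'$, $\alpha\in O\cup\{\tau\}$; (OT2) $p\vee q\xrightarrow{\alpha}q'$ if $q\xrightarrow{\alpha}_Qq'$, $\alpha\in O\cup\{\tau\}$. MIA: $(P,I,O,\longrightarrow_P,\dashrightarrow_P)$ with $I,O$ disjoint, must-relation $\subseteq P\times(I\cup O)\times(2^P\setminus\{\emptyset\})$, may-relation $\subseteq P\times(I\cup O\cup\{\tau\})\times P$,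 syntactic consistency ($p\xrightarrow{a}P'$ implies $p\stackrel{a}{\dashrightarrow}p'$ for all $p'\in P'$), and for all $i\in I$: (a) $p\xrightarrow{i}P'$, $p\xrightarrow{i}P''$ imply $P'=P''$; (b) $p\stackrel{i}{\dashrightarrow}p'$ implies $p\xrightarrow{i}P'$ for some $P'\ni p'$. $p\xrightarrow{a}p'$ abbreviates $p\xrightarrow{a}\{p'\}$; $p\stackrel{a}{\dashrightarrow}$ means some may-$a$-transition leaves $p$. Weak may: $p\stackrel{\epsilon}{\Longrightarrow}p'$ iff $p(\stackrel{\tau}{\dashrightarrow})^*p'$; $p\stackrel{\alpha}{\Longrightarrow}p'$ iff $\exists p''.\,p\stackrel{\epsilon}{\Longrightarrow}p''\stackrel{\alpha}{\dashrightarrow}p'$; $\hat\tau=\epsilon$, $\hat a=a$. $p\sqsubseteq_{\mathrm{MIA}}q$ (same $I,O$) iff some $\mathcal R$ containing $(p,q)$ satisfies for all $(p,q)\in\mathcal R$: (i) $q\xrightarrow{a}Q'$ implies some $p\xrightarrow{a}P'$ with $\forall p'\in P'\,\exists q'\in Q'.\,(p',q')\in\mathcal R$; (ii) $p\stackrel{\alpha}{\dashrightarrow}p'$ with $\alpha\in O\cup\{\tau\}$ implies some $q\stackrel{\hat\alpha}{\Longrightarrow}q'$ with $(p',q')\in\mathcal R$. MIA-disjunction (common $I,O$, disjoint state sets): states $\{p\vee q\}\cup P\cup Q$, least must/may relations containing those of $P,Q$ and satisfying (Must) $p\vee q\xrightarrow{a}P'\cup Q'$ if $p\xrightarrow{a}_PP'$,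 $q\xrightarrow{a}_QQ'$; (May1) $p\vee q\stackrel{\alpha}{\dashrightarrow}p'$ if $p\stackrel{\alpha}{\dashrightarrow}_Pp'$ and, if $\alpha\in I$, also $q\stackrel{\alpha}{\dashrightarrow}_Q$; (May2) $p\vee q\stackrel{\alpha}{\dashrightarrow}q'$ if $q\stackrel{\alpha}{\dashrightarrow}_Qq'$ and, if $\alpha\in I$, also $p\stackrel{\alpha}{\dashrightarrow}_P$. Embedding: for an IA $P$, $[\![P]\!]$ is the MIA $(P,I,O,\longrightarrow,\dashrightarrow)$ with $p\xrightarrow{i}p'$ (must) iff $p\xrightarrow{i}_Pp'$ and $i\in I$, and $p\stackrel{\alpha}{\dashrightarrow}p'$ iff $p\xrightarrow{\alpha}_Pp'$ for $\alpha\in I\cup O\cup\{\tau\}$; $[\![p]\!]$ denotes $p$ as a state of $[\![P]\!]$. -}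

module Defs where

open import Level using (0ℓ)
open import Data.Empty using (⊥)
open import Data.Sum using (_⊎_)
open import Data.Product using (Σ; Σ-syntax; ∃; ∃-syntax; _×_)
open import Relation.Binary.PropositionalEquality using (_≡_)
open import Relation.Binary.Construct.Closure.ReflexiveTransitive using (Star)

-- Actions.  I (inputs) and O (outputs) are types; visible actions are
-- I ⊎ O (disjoint by construction); τ is a separate silent action.

data Vis (I O : Set) : Set where
  vin  : I → Vis I O
  vout : O → Vis I O

data Act (I O : Set) : Set where
  ⌜_⌝ : Vis I O → Act I O
  τ   : Act I O

data OutOrTau {I O : Set} : Act I O → Set where
  isOut : (o : O) → OutOrTau ⌜ vout o ⌝
  isTau : OutOrTau τ

record LTS (I O : Set) : Set₁ where
  field
    State : Set
    trans : State → Act I O → State → Set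

record IA (I O : Set) : Set₁ where
  field
    lts : LTS I O
  open LTS lts public
  field
    inDet : ∀ {p i p′ p″} → trans p ⌜ vin i ⌝ p′ → trans p ⌜ vin i ⌝ p″ → p′ ≡ p″

data DState (S T : Set) : Set where
  _∨_  : S → T → DState S T
  left  : S → DState S T
  right : T → DState S T

-- IA-disjunction (least relation = inductive family)
module IADisj {I O : Set} (P Q : IA I O) where
  private
    module P = IA P
    module Q = IA Q

  data Trans : DState P.State Q.State → Act I O → DState P.State Q.State → Set where
    baseP : ∀ {p a p′} → P.trans p a p′ → Trans (left p) a (left p′)
    baseQ : ∀ {q a q′} → Q.trans q a q′ → Trans (right q) a (right q′)
    ruleI : ∀ {p q i p′ q′} → P.trans p ⌜ vin i ⌝ p′ → Q.trans q ⌜ vin i ⌝ q′ →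
            Trans (p ∨ q) ⌜ vin i ⌝ (p′ ∨ q′)
    ruleOT1 : ∀ {p q α p′} → OutOrTau α → P.trans p α p′ → Trans (p ∨ q) α (left p′)
    ruleOT2 : ∀ {p q α q′} → OutOrTau α → Q.trans q α q′ → Trans (p ∨ q) α (right q′)

  lts : LTS I O
  lts = record { State = DState P.State Q.State ; trans = Trans }

-- The well-formedness
-- conditions are collected separately in IsMIA; MIA-refinement and
-- MIA-disjunction are defined on the data only, as in the paper.
record MIA (I O : Set) : Set₂ where
  field
    State : Set
    must  : State → Vis I O → (State → Set) → Set₁
    may   : State → Act I O → State → Set

record IsMIA {I O : Set} (M : MIA I O) : Set₂ where
  open MIA M
  field
    mustNonEmpty : ∀ {p a P′} → must p a P′ → ∃ P′
    consistent : ∀ {p a P′ p′} → must p a P′ → P′ p′ → may p ⌜ a ⌝ p′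
    inMustDet : ∀ {p i P′ P″} → must p (vin i) P′ → must p (vin i) P″ →
                ∀ x → (P′ x → P″ x) × (P″ x → P′ x)
    inMayMust : ∀ {p i p′} → may p ⌜ vin i ⌝ p′ →
                Σ[ P′ ∈ (State → Set) ] (must p (vin i) P′ × P′ p′)

module _ {I O : Set} (M : MIA I O) where
  open MIA M

  _⇒ε_ : State → State → Set
  _⇒ε_ = Star (λ x y → may x τ y)

  WeakHat : State → Act I O → State → Set
  WeakHat p τ p′ = p ⇒ε p′
  WeakHat p ⌜ a ⌝ p′ = Σ[ p″ ∈ State ] (p ⇒ε p″ × may p″ ⌜ a ⌝ p′)

module _ {I O : Set} (M N : MIA I O) where
  private
    module M = MIA M
    module N = MIA N

  IsRefinement : (M.State → N.State → Set) → Set₁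
  IsRefinement R = ∀ {p q} → R p q →
      (∀ {a Q′} → N.must q a Q′ →
         Σ[ P′ ∈ (M.State → Set) ] (M.must p a P′ ×
           (∀ {p′} → P′ p′ → Σ[ q′ ∈ N.State ] (Q′ q′ × R p′ q′))))
    × (∀ {α p′} → OutOrTau α → M.may p α p′ →
         Σ[ q′ ∈ N.State ] (WeakHat N q α q′ × R p′ q′))

  _⊑MIA_ : M.State → N.State → Set₁
  p ⊑MIA q = Σ[ R ∈ (M.State → N.State → Set) ] (R p q × IsRefinement R)

-- (only the underlying LTS is used; input-determinism of P is what makes
-- the result satisfy IsMIA)
module Embed {I O : Set} (P : LTS I O) where
  open LTS P

  data Must : State → Vis I O → (State → Set) → Set₁ where
    emb : ∀ {p i p′} → trans p ⌜ vin i ⌝ p′ → Must p (vin i) (λ x → x ≡ p′)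

  ⟦_⟧ : MIA I O
  ⟦_⟧ = record { State = State ; must = Must ; may = trans }

liftL : {S T : Set} → (S → Set) → DState S T → Set
liftL P′ (left p) = P′ p
liftL P′ _ = ⊥

liftR : {S T : Set} → (T → Set) → DState S T → Set
liftR Q′ (right q) = Q′ q
liftR Q′ _ = ⊥

module MIADisj {I O : Set} (M N : MIA I O) where
  private
    module M = MIA M
    module N = MIA N

  InpEnabledM : M.State → Act I O → Set
  InpEnabledM p α = ∀ i → α ≡ ⌜ vin i ⌝ → ∃ (M.may p α)

  InpEnabledN : N.State → Act I O → Set
  InpEnabledN q α = ∀ i → α ≡ ⌜ vin i ⌝ → ∃ (N.may q α)

  St = DState M.State N.State

  data Must : St → Vis I O → (St → Set) → Set₁ where
    baseM : ∀ {p a P′} → M.must p a P′ → Must (left p) a (liftL P′)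
    baseN : ∀ {q a Q′} → N.must q a Q′ → Must (right q) a (liftR Q′)
    ruleMust : ∀ {p q a P′ Q′} → M.must p a P′ → N.must q a Q′ →
               Must (p ∨ q) a (λ x → liftL P′ x ⊎ liftR Q′ x)

  data May : St → Act I O → St → Set where
    baseM : ∀ {p α p′} → M.may p α p′ → May (left p) α (left p′)
    baseN : ∀ {q α q′} → N.may q α q′ → May (right q) α (right q′)
    ruleMay1 : ∀ {p q α p′} → M.may p α p′ → InpEnabledN q α → May (p ∨ q) α (left p′)
    ruleMay2 : ∀ {p q α q′} → N.may q α q′ → InpEnabledM p α → May (p ∨ q) α (right q′)

  mia : MIA I O
  mia = record { State = St ; must = Must ; may = May }

-- Relate every state of [[P]] ∨ [[Q]] to the equally named state of [[P ∨ Q]], and additionally each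
-- summand state [[p]] resp. [[q]] to p ∨ q.  An output or τ may-step of a state is then literally a
-- transition of its partner to the same target (OT1/OT2 mirror May1/May2), and an input must-step
-- of p ∨ q to p′ ∨ q′ is answered by the must-step to {p′, q′} (or {p′} resp. {q′} from a summand),
-- whose members are again related to p′ ∨ q′.
module Submission where

open import Defs
open import Data.Sum using (inj₁; inj₂)
open import Data.Product using (Σ-syntax; _×_; _,_)
open import Relation.Binary.PropositionalEquality using (refl)
open import Relation.Binary.Construct.Closure.ReflexiveTransitive using (ε; _◅_)

may⇒weakHat : {I O : Set} (M : MIA I O) {p p′ : MIA.State M} {α : Act I O} →
              OutOrTau α → MIA.may M p α p′ → WeakHat M p α p′
may⇒weakHat M {p} (isOut o) t = p , ε , t
may⇒weakHat M isTau         t = t ◅ ε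

data _≼_ {S T : Set} : DState S T → DState S T → Set where
  refl≼   : ∀ {x} → x ≼ x
  left≼∨  : ∀ {p q} → left p ≼ (p ∨ q)
  right≼∨ : ∀ {p q} → right q ≼ (p ∨ q)

module _ {I O : Set} (P Q : IA I O) where
  private
    MIA∨ = MIADisj.mia (Embed.⟦_⟧ (IA.lts P)) (Embed.⟦_⟧ (IA.lts Q))
    IA∨  = Embed.⟦_⟧ (IADisj.lts P Q)
    module MIA∨ = MIA MIA∨
    module IA∨  = MIA IA∨

  open IADisj P Q using (Trans; baseP; baseQ; ruleI; ruleOT1; ruleOT2)
  open MIADisj (Embed.⟦_⟧ (IA.lts P)) (Embed.⟦_⟧ (IA.lts Q))
    using (baseM; baseN; ruleMust; ruleMay1; ruleMay2)
  open Embed using (emb)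

  ≼-input-must : ∀ {x y i y′} → x ≼ y → Trans y ⌜ vin i ⌝ y′ →
                 Σ[ X′ ∈ (MIA∨.State → Set) ] (MIA∨.must x (vin i) X′ × (∀ {x′} → X′ x′ → x′ ≼ y′))
  ≼-input-must {left _}  refl≼ (baseP tp) = _ , baseM (emb tp) , λ { {left _} refl → refl≼ }
  ≼-input-must {right _} refl≼ (baseQ tq) = _ , baseN (emb tq) , λ { {right _} refl → refl≼ }
  ≼-input-must {_ ∨ _}   refl≼ (ruleI tp tq) =
    _ , ruleMust (emb tp) (emb tq) , λ { {left _} (inj₁ refl) → left≼∨ ; {right _} (inj₂ refl) → right≼∨ }
  ≼-input-must {_ ∨ _}   refl≼ (ruleOT1 () _)
  ≼-input-must {_ ∨ _}   refl≼ (ruleOT2 () _)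
  ≼-input-must left≼∨  (ruleI tp _) = _ , baseM (emb tp) , λ { {left _} refl → left≼∨ }
  ≼-input-must left≼∨  (ruleOT1 () _)
  ≼-input-must left≼∨  (ruleOT2 () _)
  ≼-input-must right≼∨ (ruleI _ tq) = _ , baseN (emb tq) , λ { {right _} refl → right≼∨ }
  ≼-input-must right≼∨ (ruleOT1 () _)
  ≼-input-must right≼∨ (ruleOT2 () _)

  ≼-output-may : ∀ {x y α x′} → x ≼ y → OutOrTau α → MIA∨.may x α x′ → Trans y α x′
  ≼-output-may refl≼   _ (baseM tp)      = baseP tp
  ≼-output-may refl≼   _ (baseN tq)      = baseQ tq
  ≼-output-may refl≼   o (ruleMay1 tp _) = ruleOT1 o tp
  ≼-output-may refl≼   o (ruleMay2 tq _) = ruleOT2 o tq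
  ≼-output-may left≼∨  o (baseM tp)      = ruleOT1 o tp
  ≼-output-may right≼∨ o (baseN tq)      = ruleOT2 o tq

  ≼-isRefinement : IsRefinement MIA∨ IA∨ _≼_
  ≼-isRefinement x≼y = must-clause , may-clause
    where
    must-clause : ∀ {a Y′} → IA∨.must _ a Y′ →
                  Σ[ X′ ∈ (MIA∨.State → Set) ] (MIA∨.must _ a X′ ×
                    (∀ {x′} → X′ x′ → Σ[ y′ ∈ IA∨.State ] (Y′ y′ × x′ ≼ y′)))
    must-clause (emb t) with ≼-input-must x≼y t
    ... | X′ , x→X′ , X′≼y′ = X′ , x→X′ , λ x′∈X′ → _ , refl , X′≼y′ x′∈X′

    may-clause : ∀ {α x′} → OutOrTau α → MIA∨.may _ α x′ →
                 Σ[ y′ ∈ IA∨.State ] (WeakHat IA∨ _ α y′ × x′ ≼ y′)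
    may-clause o t = _ , may⇒weakHat IA∨ o (≼-output-may x≼y o t) , refl≼

proposition4p18 : {I O : Set} (P Q : IA I O) (p : IA.State P) (q : IA.State Q) →
    _⊑MIA_ (MIADisj.mia (Embed.⟦_⟧ (IA.lts P)) (Embed.⟦_⟧ (IA.lts Q)))
    (Embed.⟦_⟧ (IADisj.lts P Q))
    (p ∨ q) (p ∨ q)
proposition4p18 P Q p q = _≼_ , refl≼ , ≼-isRefinement P Q
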